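{- Let $p,r$ be positive integers and let $S$ be a set with $n$ elements. Suppose $(A_{j1},\dots,A_{jp})$, $j=1,\dots,m$, are $m$ distinct weak compositions of $S$ into $p$ parts such that for each $k\in[p-1]$ the set $\{A_{jk}:1\le j\le m\}$ is $r$-chain-free. Then \[ \sum_{j=1}^m\frac{1}{\binom{n}{|A_{j1}|,\dots,|A_{jp}|}}\le r^{p-1}. \] Consequently, $m$ is at most the sum of the $r^{p-1}$ largest $p$-multinomial coefficients for $n$.
   Context: A weak composition of $S$ into $p$ parts is an ordered $p$-tuple $(A_1,\dots,A_p)$ of pairwise disjoint, possibly empty, subsets of $S$ with $A_1\cup\dots\cup A_p=S$. A family of subsets of $S$ is $r$-chain-free if every chain (set totally ordered by inclusion) in it has at most $r$ elements (the family is considered as a set, ignoring repetitions). $[p-1]=\{1,\dots,p-1\}$. The $p$-multinomial coefficients for $n$ are the numbers $\binom{n}{a_1,\dots,a_p}=\frac{n!}{a_1!\cdots a_p!}$, one for each ordered tuple $(a_1,\dots,a_p)$ of nonnegative integers summing to $n$; the sum of the $R$ largest means: list them (with multiplicity, one per tuple) in non-increasing order, extended by zeros if necessary, and sum the first $R$. -}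

module Defs where

open import Data.Nat as ℕ using (ℕ; zero; suc; _≤_; _<_; _!; NonZero)
open import Data.Nat.Properties using (_!≢0; m*n≢0; ≤-decTotalOrder)
open import Data.Nat.DivMod using (_/_)
open import Data.Fin using (Fin; toℕ)
open import Data.Fin.Subset using (Subset; _∈_; _∩_; _⊆_; Empty; ∣_∣)
open import Data.Vec as Vec using (Vec; []; _∷_)
open import Data.List as List using (List; []; _∷_; allFin; upTo; filter; concatMap; take; reverse)
open import Data.Integer using (+_)
open import Data.Rational as ℚ using (ℚ)
open import Data.Product using (_×_; ∃-syntax)
open import Data.Sum using (_⊎_)
open import Relation.Binary.PropositionalEquality using (_≡_; _≢_)
open import Relation.Nullary using (¬_)
open import Data.Nat.ListAction using (sum)
import Data.List.Sort

Tuple : ℕ → ℕ → Set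
Tuple p n = Fin p → Subset n

IsWeakComposition : ∀ {p n} → Tuple p n → Set
IsWeakComposition {p} {n} A =
  (∀ (i j : Fin p) → i ≢ j → Empty (A i ∩ A j)) × (∀ (x : Fin n) → ∃[ i ] (x ∈ A i))

Distinct : ∀ {m p n} → (Fin m → Tuple p n) → Set
Distinct {m} {p} A = ∀ (j j' : Fin m) → j ≢ j' → ¬ (∀ (k : Fin p) → A j k ≡ A j' k)

ChainFree : ∀ {m n} → ℕ → (Fin m → Subset n) → Set
ChainFree {m} r F =
  ∀ (c : ℕ) (g : Fin c → Fin m) →
    (∀ a b → a ≢ b → F (g a) ≢ F (g b)) →
    (∀ a b → (F (g a) ⊆ F (g b)) ⊎ (F (g b) ⊆ F (g a))) →
    c ≤ r

factProd : ∀ {p} → Vec ℕ p → ℕ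
factProd a = Vec.foldr _ ℕ._*_ 1 (Vec.map _! a)

factProd≢0 : ∀ {p} (a : Vec ℕ p) → NonZero (factProd a)
factProd≢0 [] = _
factProd≢0 (x ∷ a) = m*n≢0 (x !) (factProd a) {{x !≢0}} {{factProd≢0 a}}

multinomial : ∀ {p} → ℕ → Vec ℕ p → ℕ
multinomial n a = (n ! / factProd a) {{factProd≢0 a}}

invMultinomial : ∀ {p} → ℕ → Vec ℕ p → ℚ
invMultinomial n a = ((+ factProd a) ℚ./ (n !)) {{n !≢0}}

allVecs : (p n : ℕ) → List (Vec ℕ p)
allVecs zero n = [] ∷ []
allVecs (suc p) n = concatMap (λ x → List.map (x ∷_) (allVecs p n)) (upTo (suc n))

tuplesSumming : (p n : ℕ) → List (Vec ℕ p)
tuplesSumming p n = filter (λ a → Vec.sum a ℕ.≟ n) (allVecs p n)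

multinomialCoeffs : (p n : ℕ) → List ℕ
multinomialCoeffs p n = List.map (multinomial n) (tuplesSumming p n)

open module ℕSort = Data.List.Sort ≤-decTotalOrder using (sort)

-- sum of the R largest entries (with multiplicity; padding by zeros is implicit)
sumLargest : ℕ → List ℕ → ℕ
sumLargest R xs = sum (take R (reverse (sort xs)))

sumℚ : List ℚ → ℚ
sumℚ = List.foldr ℚ._+_ (ℚ.0ℚ)

sizes : ∀ {p n} → Tuple p n → Vec ℕ p
sizes A = Vec.tabulate (λ k → ∣ A k ∣)

-- Weight a subset B of a t-set T by |B|! (t − |B|)!, the number of maximal chains of subsets of T
-- through B. An r-chain-free family of subsets of T has total weight at most r · t!: for B ≠ T the
-- weight of B is the sum, over x ∈ T ∖ B, of its weight in the subset lattice of T − x, and the members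
-- avoiding x form an r-chain-free family there ((r − 1)-chain-free if T is a member, since T extends
-- every chain), so induction on t applies.
-- Grouping the weak compositions (A₁, …, A_p) of T by their first part B leaves weak compositions of
-- T ∖ B, so induction on p gives ∑ ∏ₖ |Aₖ|! ≤ r^(p−1) |T|!, the first claim multiplied by n!.
-- Grouping them instead by their size vector a, every group has 1-chain-free columns (comparable sets
-- of equal size coincide), hence at most M_a members, M_a the multinomial coefficient; together with
-- ∑ₐ xₐ / M_a ≤ r^(p−1) a fractional knapsack argument bounds the number ∑ₐ xₐ of compositions by the
-- sum of the r^(p−1) largest M_a.
module Submission where

open import Data.Bool using (true; false; if_then_else_)
import Data.Bool.Properties as Bool
open import Data.Fin as Fin using (Fin; zero; suc; inject₁; toℕ)
import Data.Fin.Properties as Fin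
open import Data.Fin.Subset using (Subset; _∈_; _∉_; _⊆_; _─_; _-_; ∣_∣; ⊤; inside; outside; ⁅_⁆)
open import Data.Fin.Subset.Properties
  using (_∈?_; ∈⊤; x∈p∩q⁺; ∣⊤∣≡n; ⊆-refl; ⊆-antisym; Empty-unique; ∣⊥∣≡0; x∈p∧x∉q⇒x∈p─q; p─q⊆p; x∈p∧x≢y⇒x∈p-y;
         drop-∷-⊆; p⊆q⇒∣p∣≤∣q∣; ∣⁅x⁆∣≡1; x∈⁅y⁆⇒x≡y)
open import Data.Integer as ℤ using (ℤ; +_)
import Data.Integer.Properties as ℤ
open import Data.Integer.Solver using (module +-*-Solver)
open +-*-Solver using (solve; _:+_; _:*_; _:=_)
open import Data.List as List using (List; []; _∷_; allFin; map; filter; length; deduplicate; take; reverse; upTo)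
import Data.List.Properties as List
open import Data.List.Properties
  using (map-cong; map-cong-local; map-∘; map-id; filter-all; filter-accept; filter-reject; unfold-reverse)
open import Data.List.Membership.Propositional using () renaming (_∈_ to _∈ₗ_)
open import Data.List.Membership.Propositional.Properties
  using (∈-lookup; ∈-filter⁺; ∈-map⁺; ∈-map⁻; ∈-concatMap⁺; ∈-upTo⁺; ∈-deduplicate⁺; ∈-deduplicate⁻)
open import Data.List.Relation.Binary.Disjoint.Propositional using (Disjoint)
open import Data.List.Relation.Binary.Permutation.Propositional using (↭-sym; ↭-trans)
open import Data.List.Relation.Binary.Permutation.Propositional.Properties using (All-resp-↭; ↭-reverse) renaming (map⁺ to ↭-map⁺)
open import Data.List.Relation.Binary.Subset.Propositional using () renaming (_⊆_ to _⊆ₗ_)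
open import Data.List.Relation.Binary.Subset.Propositional.Properties using (filter-⊆; filter⁺′) renaming (map⁺ to ⊆ₗ-map⁺)
open import Data.List.Relation.Unary.All as All using (All; []; _∷_)
import Data.List.Relation.Unary.All.Properties as All
open import Data.List.Relation.Unary.AllPairs as AllPairs using (AllPairs; []; _∷_)
import Data.List.Relation.Unary.AllPairs.Properties as AllPairs
open import Data.List.Relation.Unary.Any as Any using (here; there)
open import Data.List.Relation.Unary.Linked.Properties using (Linked⇒AllPairs)
open import Data.List.Relation.Unary.Unique.Propositional using (Unique)
import Data.List.Relation.Unary.Unique.Propositional.Properties as Unique
open import Data.List.Relation.Unary.Unique.DecPropositional.Properties using (deduplicate-!)
open import Data.Nat using (ℕ; zero; suc; _≟_; _+_; _*_; _∸_; _^_; _!; _≤_; _≥_; _<_; z≤n; s≤s; NonZero)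
open import Data.Nat.Combinatorics using (k![n∸k]!∣n!)
open import Data.Nat.Divisibility using (_∣_; ∣-trans; *-monoʳ-∣; 1∣_)
open import Data.Nat.DivMod using (m/n*n≡m)
open import Data.Nat.ListAction using (sum)
open import Data.Nat.ListAction.Properties using (sum-↭)
open import Data.Nat.Properties
open import Algebra.Properties.CommutativeMonoid.Sum +-0-commutativeMonoid
  using (∑-distrib-+; sum-replicate-zero; sum-cong-≗) renaming (sum to ∑)
open import Algebra.Properties.CommutativeSemigroup +-commutativeSemigroup
  using (interchange) renaming (x∙yz≈y∙xz to +-x∙yz≈y∙xz)
open import Algebra.Properties.CommutativeSemigroup *-commutativeSemigroup
  using () renaming (x∙yz≈y∙xz to *-x∙yz≈y∙xz; x∙yz≈yx∙z to *-x∙yz≈yx∙z; x∙yz≈z∙yx to *-x∙yz≈z∙yx; xy∙z≈x∙zy to *-xy∙z≈x∙zy)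
open import Data.List.Sort ≤-decTotalOrder using (sort; sort-↭; sort-↗)
open import Data.Product using (_×_; _,_; ∃-syntax; proj₁; proj₂)
open import Data.Rational as ℚ using (toℚᵘ)
import Data.Rational.Properties as ℚ
open import Data.Rational.Unnormalised as ℚᵘ using (mkℚᵘ; *≡*; *≤*)
import Data.Rational.Unnormalised.Properties as ℚᵘ
open import Data.Sum using (_⊎_; inj₁; inj₂)
open import Data.Vec as Vec using (Vec; []; _∷_; here; there; lookup)
import Data.Vec.Properties as Vec
open import Function using (id; _∘_; case_of_; flip)
open import Level using (0ℓ)
open import Relation.Binary.Definitions using (DecidableEquality)
open import Relation.Binary.PropositionalEquality
open import Relation.Nullary using (Dec; yes; no; does; ¬?; contradiction)
open import Relation.Nullary.Decidable using (dec-true; dec-false)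
open import Relation.Unary using (Pred; Decidable)
open import Defs

module _ {A : Set} where

  sum-map-+ : ∀ (f g : A → ℕ) xs → sum (map (λ x → f x + g x) xs) ≡ sum (map f xs) + sum (map g xs)
  sum-map-+ f g []       = refl
  sum-map-+ f g (x ∷ xs) = trans (cong (_+_ (f x + g x)) (sum-map-+ f g xs)) (interchange (f x) (g x) _ _)

  sum-map-*ˡ : ∀ c (f : A → ℕ) xs → sum (map (λ x → c * f x) xs) ≡ c * sum (map f xs)
  sum-map-*ˡ c f []       = sym (*-zeroʳ c)
  sum-map-*ˡ c f (x ∷ xs) = trans (cong (_+_ (c * f x)) (sum-map-*ˡ c f xs)) (sym (*-distribˡ-+ c (f x) _))

  sum-map-1 : ∀ xs → sum (map (λ (_ : A) → 1) xs) ≡ length xs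
  sum-map-1 []       = refl
  sum-map-1 (_ ∷ xs) = cong suc (sum-map-1 xs)

  sum-map-zero : ∀ xs → sum (map (λ (_ : A) → 0) xs) ≡ 0
  sum-map-zero []       = refl
  sum-map-zero (_ ∷ xs) = sum-map-zero xs

  sum-map-const : ∀ {c} (f : A → ℕ) {xs} → All (λ x → f x ≡ c) xs → sum (map f xs) ≡ length xs * c
  sum-map-const f []         = refl
  sum-map-const f (fx ∷ fxs) = cong₂ _+_ fx (sum-map-const f fxs)

  sum-map-mono : ∀ {f g : A → ℕ} {xs} → All (λ x → f x ≤ g x) xs → sum (map f xs) ≤ sum (map g xs)
  sum-map-mono []         = z≤n
  sum-map-mono (fx ∷ fxs) = +-mono-≤ fx (sum-map-mono fxs)

  sum-map-∑ : ∀ {n} (h : A → Fin n → ℕ) xs → sum (map (λ x → ∑ (h x)) xs) ≡ ∑ (λ i → sum (map (λ x → h x i) xs))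
  sum-map-∑ {n} h []       = sym (sum-replicate-zero n)
  sum-map-∑     h (x ∷ xs) = trans (cong (_+_ (∑ (h x))) (sum-map-∑ h xs)) (sym (∑-distrib-+ (h x) _))

  sum-map-filter : ∀ {P : Pred A 0ℓ} (P? : Decidable P) (g : A → ℕ) xs →
                   sum (map g (filter P? xs)) ≡ sum (map (λ x → if does (P? x) then g x else 0) xs)
  sum-map-filter P? g []       = refl
  sum-map-filter P? g (x ∷ xs) with does (P? x)
  ... | true  = cong (_+_ (g x)) (sum-map-filter P? g xs)
  ... | false = sum-map-filter P? g xs

module _ {A : Set} (_≟ᴬ_ : DecidableEquality A) where

  sum-map-≟-∉ : ∀ {x} c {ys} → All (x ≢_) ys → sum (map (λ y → if does (x ≟ᴬ y) then c else 0) ys) ≡ 0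
  sum-map-≟-∉ c []           = refl
  sum-map-≟-∉ c (x≢y ∷ x∉ys) = cong₂ _+_ (cong (if_then c else 0) (dec-false (_ ≟ᴬ _) x≢y)) (sum-map-≟-∉ c x∉ys)

  sum-map-≟-∈ : ∀ {x} c {ys} → Unique ys → x ∈ₗ ys → sum (map (λ y → if does (x ≟ᴬ y) then c else 0) ys) ≡ c
  sum-map-≟-∈ c (x∉ys ∷ _) (here refl) =
    trans (cong₂ _+_ (cong (if_then c else 0) (dec-true (_ ≟ᴬ _) refl)) (sum-map-≟-∉ c x∉ys)) (+-identityʳ c)
  sum-map-≟-∈ c (y∉ys ∷ ys!) (there x∈ys) =
    cong₂ _+_ (cong (if_then c else 0) (dec-false (_ ≟ᴬ _) λ { refl → All.lookup y∉ys x∈ys refl })) (sum-map-≟-∈ c ys! x∈ys)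

  sum-map-remove : ∀ (f : A → ℕ) {x xs} → Unique xs → x ∈ₗ xs →
                   sum (map f xs) ≡ f x + sum (map f (filter (λ y → ¬? (y ≟ᴬ x)) xs))
  sum-map-remove f {x} (x∉xs ∷ _) (here refl) =
    cong (λ ys → f x + sum (map f ys)) (sym (trans (filter-reject (λ y → ¬? (y ≟ᴬ x)) (λ x≢x → x≢x refl))
                                                   (filter-all (λ y → ¬? (y ≟ᴬ x)) (All.map (_∘ sym) x∉xs))))
  sum-map-remove f {x} {y ∷ xs} (y∉xs ∷ xs!) (there x∈xs) = begin
    f y + sum (map f xs)
      ≡⟨ cong (_+_ (f y)) (sum-map-remove f xs! x∈xs) ⟩
    f y + (f x + sum (map f (filter ≢x? xs)))
      ≡⟨ +-x∙yz≈y∙xz (f y) (f x) _ ⟩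
    f x + sum (map f (y ∷ filter ≢x? xs))
      ≡⟨ cong (λ ys → f x + sum (map f ys)) (filter-accept ≢x? (All.lookup y∉xs x∈xs)) ⟨
    f x + sum (map f (filter ≢x? (y ∷ xs))) ∎
    where
    open ≡-Reasoning
    ≢x? : Decidable (_≢ x)
    ≢x? y = ¬? (y ≟ᴬ x)

module _ {A K : Set} (_≟ᴷ_ : DecidableEquality K) (key : A → K) where

  fiber : K → List A → List A
  fiber k = filter (λ x → key x ≟ᴷ k)

  sum-map-fibers : ∀ (g : A → ℕ) {ks} xs → Unique ks → All (λ x → key x ∈ₗ ks) xs →
                   sum (map (λ k → sum (map g (fiber k xs))) ks) ≡ sum (map g xs)
  sum-map-fibers g {ks} []       _   _               = sum-map-zero ks
  sum-map-fibers g {ks} (x ∷ xs) ks! (x∈ks ∷ xs∈ks) = begin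
    sum (map (λ k → sum (map g (fiber k (x ∷ xs)))) ks)
      ≡⟨ cong sum (map-cong (λ k → trans (sum-map-filter (λ y → key y ≟ᴷ k) g (x ∷ xs))
                                         (cong (_+_ _) (sym (sum-map-filter (λ y → key y ≟ᴷ k) g xs)))) ks) ⟩
    sum (map (λ k → (if does (key x ≟ᴷ k) then g x else 0) + sum (map g (fiber k xs))) ks)
      ≡⟨ sum-map-+ _ _ ks ⟩
    sum (map (λ k → if does (key x ≟ᴷ k) then g x else 0) ks) + sum (map (λ k → sum (map g (fiber k xs))) ks)
      ≡⟨ cong₂ _+_ (sum-map-≟-∈ _≟ᴷ_ (g x) ks! x∈ks) (sum-map-fibers g xs ks! xs∈ks) ⟩
    g x + sum (map g xs) ∎
    where open ≡-Reasoning

unique-constant⇒length≤1 : ∀ {A : Set} {x : A} {xs} → Unique xs → All (_≡ x) xs → length xs ≤ 1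
unique-constant⇒length≤1 {xs = []}        _               _                 = z≤n
unique-constant⇒length≤1 {xs = _ ∷ []}    _               _                 = s≤s z≤n
unique-constant⇒length≤1 {xs = _ ∷ _ ∷ _} ((a≢b ∷ _) ∷ _) (refl ∷ refl ∷ _) = contradiction refl a≢b

Unique-lookup-injective : ∀ {A : Set} {xs : List A} → Unique xs → ∀ {i j} → List.lookup xs i ≡ List.lookup xs j → i ≡ j
Unique-lookup-injective {xs = _ ∷ _} _          {zero}  {zero}  _     = refl
Unique-lookup-injective {xs = _ ∷ _} (x∉xs ∷ _) {zero}  {suc j} x≡xⱼ  = contradiction x≡xⱼ (All.lookup x∉xs (∈-lookup j))
Unique-lookup-injective {xs = _ ∷ _} (x∉xs ∷ _) {suc i} {zero}  xᵢ≡x  = contradiction (sym xᵢ≡x) (All.lookup x∉xs (∈-lookup i))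
Unique-lookup-injective {xs = _ ∷ _} (_ ∷ xs!)  {suc i} {suc j} xᵢ≡xⱼ = cong suc (Unique-lookup-injective xs! xᵢ≡xⱼ)

x∈p─q⇒x∉q : ∀ {n} (p q : Subset n) {x} → x ∈ p ─ q → x ∉ q
x∈p─q⇒x∉q (_ ∷ p) (outside ∷ q) here       ()
x∈p─q⇒x∉q (_ ∷ p) (outside ∷ q) (there x∈) (there x∈q) = x∈p─q⇒x∉q p q x∈ x∈q
x∈p─q⇒x∉q (_ ∷ p) (inside ∷ q)  (there x∈) (there x∈q) = x∈p─q⇒x∉q p q x∈ x∈q

∣p─q∣+∣q∣≡∣p∣ : ∀ {n} (p q : Subset n) → q ⊆ p → ∣ p ─ q ∣ + ∣ q ∣ ≡ ∣ p ∣
∣p─q∣+∣q∣≡∣p∣ []            []            _   = refl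
∣p─q∣+∣q∣≡∣p∣ (inside ∷ p)  (inside ∷ q)  q⊆p = trans (+-suc _ _) (cong suc (∣p─q∣+∣q∣≡∣p∣ p q (drop-∷-⊆ q⊆p)))
∣p─q∣+∣q∣≡∣p∣ (inside ∷ p)  (outside ∷ q) q⊆p = cong suc (∣p─q∣+∣q∣≡∣p∣ p q (drop-∷-⊆ q⊆p))
∣p─q∣+∣q∣≡∣p∣ (outside ∷ p) (outside ∷ q) q⊆p = ∣p─q∣+∣q∣≡∣p∣ p q (drop-∷-⊆ q⊆p)
∣p─q∣+∣q∣≡∣p∣ (outside ∷ p) (inside ∷ q)  q⊆p with () ← q⊆p here

∣p─q∣≡∣p∣∸∣q∣ : ∀ {n} (p q : Subset n) → q ⊆ p → ∣ p ─ q ∣ ≡ ∣ p ∣ ∸ ∣ q ∣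
∣p─q∣≡∣p∣∸∣q∣ p q q⊆p = trans (sym (m+n∸n≡m _ ∣ q ∣)) (cong (_∸ ∣ q ∣) (∣p─q∣+∣q∣≡∣p∣ p q q⊆p))

p⊆q∧∣p∣≡∣q∣⇒p≡q : ∀ {n} (p q : Subset n) → p ⊆ q → ∣ p ∣ ≡ ∣ q ∣ → p ≡ q
p⊆q∧∣p∣≡∣q∣⇒p≡q []            []            _   _ = refl
p⊆q∧∣p∣≡∣q∣⇒p≡q (inside ∷ p)  (inside ∷ q)  p⊆q e = cong (inside ∷_) (p⊆q∧∣p∣≡∣q∣⇒p≡q p q (drop-∷-⊆ p⊆q) (suc-injective e))
p⊆q∧∣p∣≡∣q∣⇒p≡q (outside ∷ p) (outside ∷ q) p⊆q e = cong (outside ∷_) (p⊆q∧∣p∣≡∣q∣⇒p≡q p q (drop-∷-⊆ p⊆q) e)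
p⊆q∧∣p∣≡∣q∣⇒p≡q (inside ∷ p)  (outside ∷ q) p⊆q e with () ← p⊆q here
p⊆q∧∣p∣≡∣q∣⇒p≡q (outside ∷ p) (inside ∷ q)  p⊆q e = contradiction e (<⇒≢ (s≤s (p⊆q⇒∣p∣≤∣q∣ (drop-∷-⊆ p⊆q))))

p⊆q∧p≢q⇒∣p∣<∣q∣ : ∀ {n} {p q : Subset n} → p ⊆ q → p ≢ q → ∣ p ∣ < ∣ q ∣
p⊆q∧p≢q⇒∣p∣<∣q∣ {p = p} {q} p⊆q p≢q with m≤n⇒m<n∨m≡n (p⊆q⇒∣p∣≤∣q∣ p⊆q)
... | inj₁ ∣p∣<∣q∣ = ∣p∣<∣q∣
... | inj₂ ∣p∣≡∣q∣ = contradiction (p⊆q∧∣p∣≡∣q∣⇒p≡q p q p⊆q ∣p∣≡∣q∣) p≢q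

x∈p⇒suc∣p-x∣≡∣p∣ : ∀ {n} (p : Subset n) {x} → x ∈ p → suc ∣ p - x ∣ ≡ ∣ p ∣
x∈p⇒suc∣p-x∣≡∣p∣ p {x} x∈p = begin
  suc ∣ p - x ∣         ≡⟨ +-comm 1 _ ⟩
  ∣ p - x ∣ + 1         ≡⟨ cong (_+_ ∣ p - x ∣) (∣⁅x⁆∣≡1 x) ⟨
  ∣ p - x ∣ + ∣ ⁅ x ⁆ ∣ ≡⟨ ∣p─q∣+∣q∣≡∣p∣ p ⁅ x ⁆ (λ y∈⁅x⁆ → subst (_∈ p) (sym (x∈⁅y⁆⇒x≡y x y∈⁅x⁆)) x∈p) ⟩
  ∣ p ∣                 ∎
  where open ≡-Reasoning

x∈p⇒does[x∈?p─q]≡does[x∉?q] : ∀ {n} {p q : Subset n} {x} → x ∈ p → does (x ∈? p ─ q) ≡ does (¬? (x ∈? q))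
x∈p⇒does[x∈?p─q]≡does[x∉?q] {p = p} {q} {x} x∈p with x ∈? q
... | yes x∈q = dec-false (x ∈? p ─ q) (λ x∈p─q → x∈p─q⇒x∉q p q x∈p─q x∈q)
... | no  x∉q = dec-true  (x ∈? p ─ q) (x∈p∧x∉q⇒x∈p─q x∈p x∉q)

∑∈ : ∀ {n} → Subset n → (Fin n → ℕ) → ℕ
∑∈ p f = ∑ (λ x → if does (x ∈? p) then f x else 0)

syntax ∑∈ p (λ x → e) = ∑[ x ∈ p ] e

∑∈-const : ∀ {n} (p : Subset n) c → ∑[ x ∈ p ] c ≡ ∣ p ∣ * c
∑∈-const []            c = refl
∑∈-const (inside ∷ p)  c = cong (_+_ c) (∑∈-const p c)
∑∈-const (outside ∷ p) c = ∑∈-const p c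

∑∈-mono : ∀ {n} (p : Subset n) {f g : Fin n → ℕ} → (∀ {x} → x ∈ p → f x ≤ g x) → ∑∈ p f ≤ ∑∈ p g
∑∈-mono {zero}  []      f≤g = z≤n
∑∈-mono {suc n} (s ∷ p) {f} {g} f≤g = +-mono-≤ (head-≤ s f≤g) (∑∈-mono p {f ∘ suc} {g ∘ suc} (λ x∈p → f≤g (there x∈p)))
  where
  head-≤ : ∀ s {f g : Fin (suc n) → ℕ} → (∀ {x} → x ∈ s ∷ p → f x ≤ g x) →
           (if does (zero ∈? s ∷ p) then f zero else 0) ≤ (if does (zero ∈? s ∷ p) then g zero else 0)
  head-≤ inside  f≤g = f≤g here
  head-≤ outside _   = z≤n

-- The LYM inequality for r-chain-free families

module _ {n : ℕ} where

  _≟ₛ_ : DecidableEquality (Subset n)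
  _≟ₛ_ = Vec.≡-dec Bool._≟_

  _∉?_ : ∀ x (B : Subset n) → Dec (x ∉ B)
  x ∉? B = ¬? (x ∈? B)

  Comparable : Subset n → Subset n → Set
  Comparable B B′ = B ⊆ B′ ⊎ B′ ⊆ B

  ChainFreeList : ℕ → List (Subset n) → Set
  ChainFreeList r D = ∀ C → Unique C → C ⊆ₗ D → (∀ {B B′} → B ∈ₗ C → B′ ∈ₗ C → Comparable B B′) → length C ≤ r

  ChainFreeList-⊆ : ∀ {r D D′} → D′ ⊆ₗ D → ChainFreeList r D → ChainFreeList r D′
  ChainFreeList-⊆ D′⊆D D-cf C C! C⊆D′ C-chain = D-cf C C! (D′⊆D ∘ C⊆D′) C-chain

  avoiding : Fin n → List (Subset n) → List (Subset n)
  avoiding x = filter (x ∉?_)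

  ChainFreeList-avoiding : ∀ {r T D x} → T ∈ₗ D → All (_⊆ T) D → ChainFreeList (suc r) D → x ∈ T →
                           ChainFreeList r (avoiding x D)
  ChainFreeList-avoiding {T = T} {D} {x} T∈D D⊆T D-cf x∈T C C! C⊆ C-chain =
    ≤-pred (D-cf (T ∷ C) (T∉C ∷ C!) T∷C⊆D T∷C-chain)
    where
    C⊆D : C ⊆ₗ D
    C⊆D = filter-⊆ (x ∉?_) D ∘ C⊆
    T∉C : All (T ≢_) C
    T∉C = All.tabulate λ B∈C T≡B → All.lookup (All.all-filter (x ∉?_) D) (C⊆ B∈C) (subst (x ∈_) T≡B x∈T)
    T∷C⊆D : T ∷ C ⊆ₗ D
    T∷C⊆D (here refl)  = T∈D
    T∷C⊆D (there B∈C) = C⊆D B∈C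
    T∷C-chain : ∀ {B B′} → B ∈ₗ T ∷ C → B′ ∈ₗ T ∷ C → Comparable B B′
    T∷C-chain (here refl) (here refl)   = inj₁ ⊆-refl
    T∷C-chain (here refl) (there B′∈C)  = inj₂ (All.lookup D⊆T (C⊆D B′∈C))
    T∷C-chain (there B∈C) (here refl)   = inj₁ (All.lookup D⊆T (C⊆D B∈C))
    T∷C-chain (there B∈C) (there B′∈C) = C-chain B∈C B′∈C

  chainsThrough : ℕ → Subset n → ℕ
  chainsThrough t B = ∣ B ∣ ! * (t ∸ ∣ B ∣) !

  chainsThrough-self : ∀ {t T} → ∣ T ∣ ≡ t → chainsThrough t T ≡ t !
  chainsThrough-self {t} refl = begin
    t ! * (t ∸ t) ! ≡⟨ cong (λ s → t ! * s !) (n∸n≡0 t) ⟩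
    t ! * 1         ≡⟨ *-identityʳ (t !) ⟩
    t !             ∎
    where open ≡-Reasoning

  chainsThrough-suc : ∀ t {T B} → B ⊆ T → ∣ T ∣ ≡ suc t → ∣ B ∣ ≤ t →
                      chainsThrough (suc t) B ≡ ∑[ x ∈ T ─ B ] chainsThrough t B
  chainsThrough-suc t {T} {B} B⊆T ∣T∣≡1+t ∣B∣≤t = begin
    ∣ B ∣ ! * (suc t ∸ ∣ B ∣) !       ≡⟨ cong (λ s → ∣ B ∣ ! * s !) 1+t∸∣B∣≡1+k ⟩
    ∣ B ∣ ! * (suc k * k !)           ≡⟨ *-x∙yz≈y∙xz (∣ B ∣ !) (suc k) (k !) ⟩
    suc k * chainsThrough t B         ≡⟨ cong (_* chainsThrough t B) ∣T─B∣≡1+k ⟨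
    ∣ T ─ B ∣ * chainsThrough t B     ≡⟨ ∑∈-const (T ─ B) (chainsThrough t B) ⟨
    ∑[ x ∈ T ─ B ] chainsThrough t B  ∎
    where
    open ≡-Reasoning
    k : ℕ
    k = t ∸ ∣ B ∣
    1+t∸∣B∣≡1+k : suc t ∸ ∣ B ∣ ≡ suc k
    1+t∸∣B∣≡1+k = +-∸-assoc 1 ∣B∣≤t
    ∣T─B∣≡1+k : ∣ T ─ B ∣ ≡ suc k
    ∣T─B∣≡1+k = trans (∣p─q∣≡∣p∣∸∣q∣ T B B⊆T) (trans (cong (_∸ ∣ B ∣) ∣T∣≡1+t) 1+t∸∣B∣≡1+k)

  chainsThrough-─ : ∀ {T B} → B ⊆ T → chainsThrough ∣ T ∣ B ≡ ∣ B ∣ ! * ∣ T ─ B ∣ !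
  chainsThrough-─ {T} {B} B⊆T = cong (λ s → ∣ B ∣ ! * s !) (sym (∣p─q∣≡∣p∣∸∣q∣ T B B⊆T))

  -- Double counting of the pairs (B, x) with x ∈ T ∖ B.
  sum-chainsThrough-suc : ∀ t {T} D → ∣ T ∣ ≡ suc t → All (_⊆ T) D → All (_≢ T) D →
                          sum (map (chainsThrough (suc t)) D) ≡ ∑[ x ∈ T ] sum (map (chainsThrough t) (avoiding x D))
  sum-chainsThrough-suc t {T} D ∣T∣≡1+t D⊆T D≢T = begin
    sum (map (chainsThrough (suc t)) D)
      ≡⟨ cong sum (map-cong-local (All.zipWith chainsThrough-suc′ (D⊆T , D≢T))) ⟩
    sum (map (λ B → ∑[ x ∈ T ─ B ] chainsThrough t B) D)
      ≡⟨ sum-map-∑ (λ B x → if does (x ∈? T ─ B) then chainsThrough t B else 0) D ⟩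
    ∑ (λ x → sum (map (λ B → if does (x ∈? T ─ B) then chainsThrough t B else 0) D))
      ≡⟨ sum-cong-≗ slice ⟩
    ∑[ x ∈ T ] sum (map (chainsThrough t) (avoiding x D)) ∎
    where
    open ≡-Reasoning
    chainsThrough-suc′ : ∀ {B} → B ⊆ T × B ≢ T → chainsThrough (suc t) B ≡ ∑[ x ∈ T ─ B ] chainsThrough t B
    chainsThrough-suc′ {B} (B⊆T , B≢T) =
      chainsThrough-suc t B⊆T ∣T∣≡1+t (≤-pred (subst (∣ B ∣ <_) ∣T∣≡1+t (p⊆q∧p≢q⇒∣p∣<∣q∣ B⊆T B≢T)))
    slice : ∀ x → sum (map (λ B → if does (x ∈? T ─ B) then chainsThrough t B else 0) D)
                  ≡ (if does (x ∈? T) then sum (map (chainsThrough t) (avoiding x D)) else 0)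
    slice x with x ∈? T
    ... | no x∉T  = trans (cong sum (map-cong (λ B → cong (if_then _ else 0) (dec-false (x ∈? T ─ B) (x∉T ∘ p─q⊆p T B))) D))
                          (sum-map-zero D)
    ... | yes x∈T = trans (cong sum (map-cong (λ B → cong (if_then _ else 0) (x∈p⇒does[x∈?p─q]≡does[x∉?q] x∈T)) D))
                          (sym (sum-map-filter (x ∉?_) (chainsThrough t) D))

  mutual
    lym : ∀ t (T : Subset n) → ∣ T ∣ ≡ t → ∀ r D → Unique D → All (_⊆ T) D → ChainFreeList r D →
          sum (map (chainsThrough t) D) ≤ r * t !
    lym t T ∣T∣≡t r D D! D⊆T D-cf with Any.any? (T ≟ₛ_) D
    ... | yes T∈D = lym-∈ t T ∣T∣≡t r D D! D⊆T D-cf T∈D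
    ... | no  T∉D = lym-∉ t T ∣T∣≡t r D D! D⊆T (All.tabulate λ B∈D B≡T → T∉D (subst (_∈ₗ D) B≡T B∈D))
                          (λ x _ → ChainFreeList-⊆ (filter-⊆ (x ∉?_) D) D-cf)

    lym-∈ : ∀ t (T : Subset n) → ∣ T ∣ ≡ t → ∀ r D → Unique D → All (_⊆ T) D → ChainFreeList r D → T ∈ₗ D →
            sum (map (chainsThrough t) D) ≤ r * t !
    lym-∈ t T ∣T∣≡t zero D D! D⊆T D-cf T∈D =
      contradiction (D-cf (T ∷ []) ([] ∷ []) (λ { {_} (here refl) → T∈D }) (λ { {_} {_} (here refl) (here refl) → inj₁ ⊆-refl }))
                    λ ()
    lym-∈ t T ∣T∣≡t (suc r) D D! D⊆T D-cf T∈D = begin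
      sum (map (chainsThrough t) D)
        ≡⟨ sum-map-remove _≟ₛ_ (chainsThrough t) D! T∈D ⟩
      chainsThrough t T + sum (map (chainsThrough t) D′)
        ≡⟨ cong (_+ sum (map (chainsThrough t) D′)) (chainsThrough-self {T = T} ∣T∣≡t) ⟩
      t ! + sum (map (chainsThrough t) D′)
        ≤⟨ +-monoʳ-≤ (t !) (lym-∉ t T ∣T∣≡t r D′ (Unique.filter⁺ ≢T? D!) (All.filter⁺ ≢T? D⊆T) (All.all-filter ≢T? D) D′-cf) ⟩
      t ! + r * t ! ∎
      where
      open ≤-Reasoning
      ≢T? : Decidable (_≢ T)
      ≢T? B = ¬? (B ≟ₛ T)
      D′ : List (Subset n)
      D′ = filter ≢T? D
      D′-cf : ∀ x → x ∈ T → ChainFreeList r (avoiding x D′)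
      D′-cf x x∈T = ChainFreeList-⊆ (filter⁺′ (x ∉?_) (x ∉?_) id (filter-⊆ ≢T? D)) (ChainFreeList-avoiding T∈D D⊆T D-cf x∈T)

    lym-∉ : ∀ t (T : Subset n) → ∣ T ∣ ≡ t → ∀ r D → Unique D → All (_⊆ T) D → All (_≢ T) D →
            (∀ x → x ∈ T → ChainFreeList r (avoiding x D)) → sum (map (chainsThrough t) D) ≤ r * t !
    lym-∉ _       _ _       _ []      _  _         _         _ = z≤n
    lym-∉ zero    T ∣T∣≡0   r (B ∷ D) _  (B⊆T ∷ _) (B≢T ∷ _) _ =
      contradiction (subst (∣ B ∣ <_) ∣T∣≡0 (p⊆q∧p≢q⇒∣p∣<∣q∣ B⊆T B≢T)) λ ()
    lym-∉ (suc t) T ∣T∣≡1+t r D D! D⊆T D≢T avoiding-cf = begin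
      sum (map (chainsThrough (suc t)) D)                    ≡⟨ sum-chainsThrough-suc t D ∣T∣≡1+t D⊆T D≢T ⟩
      ∑[ x ∈ T ] sum (map (chainsThrough t) (avoiding x D))  ≤⟨ ∑∈-mono T slice-bound ⟩
      ∑[ x ∈ T ] (r * t !)                                   ≡⟨ ∑∈-const T (r * t !) ⟩
      ∣ T ∣ * (r * t !)                                      ≡⟨ cong (_* (r * t !)) ∣T∣≡1+t ⟩
      suc t * (r * t !)                                      ≡⟨ *-x∙yz≈y∙xz (suc t) r (t !) ⟩
      r * (suc t) !                                          ∎
      where
      open ≤-Reasoning
      slice-bound : ∀ {x} → x ∈ T → sum (map (chainsThrough t) (avoiding x D)) ≤ r * t !
      slice-bound {x} x∈T = lym t (T - x) (suc-injective (trans (x∈p⇒suc∣p-x∣≡∣p∣ T x∈T) ∣T∣≡1+t)) r (avoiding x D)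
                              (Unique.filter⁺ (x ∉?_) D!) avoiding⊆T-x (avoiding-cf x x∈T)
        where
        ⊆T-x : ∀ {B} → B ⊆ T × x ∉ B → B ⊆ T - x
        ⊆T-x (B⊆T , x∉B) y∈B = x∈p∧x≢y⇒x∈p-y (B⊆T y∈B) λ { refl → x∉B y∈B }
        avoiding⊆T-x : All (_⊆ T - x) (avoiding x D)
        avoiding⊆T-x = All.zipWith ⊆T-x (All.filter⁺ (x ∉?_) D⊆T , All.all-filter (x ∉?_) D)

-- Weak compositions

record IsWeakCompositionOf {n p} (T : Subset n) (v : Vec (Subset n) p) : Set where
  field
    disjoint : ∀ {i j x} → x ∈ lookup v i → x ∈ lookup v j → i ≡ j
    covers   : ∀ {x} → x ∈ T → ∃[ i ] x ∈ lookup v i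
    parts⊆   : ∀ i → lookup v i ⊆ T

module _ {n : ℕ} where

  open IsWeakCompositionOf

  IsWeakCompositionOf-tail : ∀ {p T} (v : Vec (Subset n) (suc p)) → IsWeakCompositionOf T v →
                             IsWeakCompositionOf (T ─ lookup v zero) (Vec.tail v)
  IsWeakCompositionOf-tail {T = T} (B ∷ v) wc = record
    { disjoint = λ x∈vᵢ x∈vⱼ → Fin.suc-injective (disjoint wc x∈vᵢ x∈vⱼ)
    ; covers   = λ x∈T─B → case covers wc (p─q⊆p T B x∈T─B) of λ
        { (zero  , x∈B)  → contradiction x∈B (x∈p─q⇒x∉q T B x∈T─B)
        ; (suc i , x∈vᵢ) → i , x∈vᵢ }
    ; parts⊆   = λ i x∈vᵢ → x∈p∧x∉q⇒x∈p─q (parts⊆ wc (suc i) x∈vᵢ) (λ x∈B → case disjoint wc {suc i} {zero} x∈vᵢ x∈B of λ ())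
    }

  IsWeakCompositionOf-singleton : ∀ {T B : Subset n} → IsWeakCompositionOf T (B ∷ []) → B ≡ T
  IsWeakCompositionOf-singleton wc = ⊆-antisym (parts⊆ wc zero) (λ x∈T → case covers wc x∈T of λ { (zero , x∈B) → x∈B })

  IsWeakCompositionOf-sum : ∀ {p T} (v : Vec (Subset n) p) → IsWeakCompositionOf T v → Vec.sum (Vec.map ∣_∣ v) ≡ ∣ T ∣
  IsWeakCompositionOf-sum [] wc =
    sym (trans (cong ∣_∣ (Empty-unique λ (x , x∈T) → case covers wc x∈T of λ ())) (∣⊥∣≡0 n))
  IsWeakCompositionOf-sum {T = T} (B ∷ v) wc = begin
    ∣ B ∣ + Vec.sum (Vec.map ∣_∣ v) ≡⟨ cong (_+_ ∣ B ∣) (IsWeakCompositionOf-sum v (IsWeakCompositionOf-tail (B ∷ v) wc)) ⟩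
    ∣ B ∣ + ∣ T ─ B ∣               ≡⟨ +-comm ∣ B ∣ _ ⟩
    ∣ T ─ B ∣ + ∣ B ∣               ≡⟨ ∣p─q∣+∣q∣≡∣p∣ T B (parts⊆ wc zero) ⟩
    ∣ T ∣                           ∎
    where open ≡-Reasoning

  factProdSizes : ∀ {p} → Vec (Subset n) p → ℕ
  factProdSizes v = factProd (Vec.map ∣_∣ v)

  column : ∀ {p} → Fin p → List (Vec (Subset n) p) → List (Subset n)
  column k = map (λ v → lookup v k)

  module _ {p : ℕ} where

    withFirst : Subset n → List (Vec (Subset n) (suc p)) → List (Vec (Subset n) (suc p))
    withFirst = fiber _≟ₛ_ (λ v → lookup v zero)

    rests : Subset n → List (Vec (Subset n) (suc p)) → List (Vec (Subset n) p)
    rests B F = map Vec.tail (withFirst B F)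

    withFirst-first : ∀ B F → All (λ v → lookup v zero ≡ B) (withFirst B F)
    withFirst-first B = All.all-filter (λ v → lookup v zero ≟ₛ B)

    sum-factProdSizes-withFirst : ∀ B F →
                                  sum (map factProdSizes (withFirst B F)) ≡ ∣ B ∣ ! * sum (map factProdSizes (rests B F))
    sum-factProdSizes-withFirst B F = begin
      sum (map factProdSizes G)
        ≡⟨ cong sum (map-cong-local (All.map (λ {v} → ∷-factProdSizes {v}) (withFirst-first B F))) ⟩
      sum (map (λ v → ∣ B ∣ ! * factProdSizes (Vec.tail v)) G)
        ≡⟨ sum-map-*ˡ (∣ B ∣ !) (factProdSizes ∘ Vec.tail) G ⟩
      ∣ B ∣ ! * sum (map (factProdSizes ∘ Vec.tail) G)
        ≡⟨ cong (λ ws → ∣ B ∣ ! * sum ws) (map-∘ G) ⟩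
      ∣ B ∣ ! * sum (map factProdSizes (rests B F)) ∎
      where
      open ≡-Reasoning
      G : List (Vec (Subset n) (suc p))
      G = withFirst B F
      ∷-factProdSizes : ∀ {v : Vec (Subset n) (suc p)} → lookup v zero ≡ B →
                        factProdSizes v ≡ ∣ B ∣ ! * factProdSizes (Vec.tail v)
      ∷-factProdSizes {_ ∷ _} refl = refl

    rests-unique : ∀ {B F} → Unique F → Unique (rests B F)
    rests-unique {B} {F} F! = Unique.map⁻ (subst Unique (sym B∷rests≡withFirst) (Unique.filter⁺ (λ v → lookup v zero ≟ₛ B) F!))
      where
      ∷-tail : ∀ {v : Vec (Subset n) (suc p)} → lookup v zero ≡ B → B ∷ Vec.tail v ≡ v
      ∷-tail {_ ∷ _} refl = refl
      B∷rests≡withFirst : map (B ∷_) (rests B F) ≡ withFirst B F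
      B∷rests≡withFirst = trans (sym (map-∘ (withFirst B F)))
                                (trans (map-cong-local (All.map (λ {v} → ∷-tail {v}) (withFirst-first B F)))
                                       (map-id (withFirst B F)))

    rests-wc : ∀ {T B F} → All (IsWeakCompositionOf T) F → All (IsWeakCompositionOf (T ─ B)) (rests B F)
    rests-wc {B = B} {F} F-wc = All.map⁺ (All.map (λ { {v} (wc , refl) → IsWeakCompositionOf-tail v wc })
                                                   (All.zip (All.filter⁺ (λ v → lookup v zero ≟ₛ B) F-wc , withFirst-first B F)))

    column-rests : ∀ k B F → column k (rests B F) ⊆ₗ column (suc k) F
    column-rests k B F = subst (_⊆ₗ column (suc k) F) (sym column-tail) (⊆ₗ-map⁺ _ (filter-⊆ (λ v → lookup v zero ≟ₛ B) F))
      where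
      column-tail : column k (rests B F) ≡ column (suc k) (withFirst B F)
      column-tail = trans (sym (map-∘ (withFirst B F))) (map-cong (λ { (_ ∷ _) → refl }) (withFirst B F))

  productLym : ∀ q r (T : Subset n) (F : List (Vec (Subset n) (suc q))) → Unique F → All (IsWeakCompositionOf T) F →
               (∀ (k : Fin q) → ChainFreeList r (column (inject₁ k) F)) →
               sum (map factProdSizes F) ≤ r ^ q * ∣ T ∣ !
  productLym zero r T F F! F-wc _ = begin
    sum (map factProdSizes F)  ≡⟨ sum-map-const factProdSizes (All.map (cong factProdSizes) F≡[T]) ⟩
    length F * (∣ T ∣ ! * 1)   ≤⟨ *-monoˡ-≤ _ (unique-constant⇒length≤1 F! F≡[T]) ⟩
    1 * (∣ T ∣ ! * 1)          ≡⟨ cong (1 *_) (*-identityʳ _) ⟩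
    1 * ∣ T ∣ !                ∎
    where
    open ≤-Reasoning
    F≡[T] : All (_≡ T ∷ []) F
    F≡[T] = All.map (λ { {_ ∷ []} wc → cong (_∷ []) (IsWeakCompositionOf-singleton wc) }) F-wc
  productLym (suc q) r T F F! F-wc F-cf = begin
    sum (map factProdSizes F)
      ≡⟨ sum-map-fibers _≟ₛ_ (λ v → lookup v zero) factProdSizes F firsts! (All.tabulate (∈-deduplicate⁺ _≟ₛ_ ∘ ∈-map⁺ _)) ⟨
    sum (map (λ B → sum (map factProdSizes (withFirst B F))) firsts)
      ≡⟨ cong sum (map-cong (λ B → sum-factProdSizes-withFirst B F) firsts) ⟩
    sum (map (λ B → ∣ B ∣ ! * sum (map factProdSizes (rests B F))) firsts)
      ≤⟨ sum-map-mono (All.tabulate rests-bound) ⟩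
    sum (map (λ B → r ^ q * chainsThrough ∣ T ∣ B) firsts)
      ≡⟨ sum-map-*ˡ (r ^ q) (chainsThrough ∣ T ∣) firsts ⟩
    r ^ q * sum (map (chainsThrough ∣ T ∣) firsts)
      ≤⟨ *-monoʳ-≤ (r ^ q) (lym ∣ T ∣ T refl r firsts firsts! firsts⊆T (ChainFreeList-⊆ firsts⊆column (F-cf zero))) ⟩
    r ^ q * (r * ∣ T ∣ !)
      ≡⟨ *-x∙yz≈yx∙z (r ^ q) r (∣ T ∣ !) ⟩
    r ^ suc q * ∣ T ∣ ! ∎
    where
    open ≤-Reasoning
    firsts : List (Subset n)
    firsts = deduplicate _≟ₛ_ (column zero F)
    firsts! : Unique firsts
    firsts! = deduplicate-! _≟ₛ_ (column zero F)
    firsts⊆column : firsts ⊆ₗ column zero F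
    firsts⊆column = ∈-deduplicate⁻ _≟ₛ_ (column zero F)
    firsts⊆T : All (_⊆ T) firsts
    firsts⊆T = All.tabulate λ B∈firsts → case ∈-map⁻ _ (firsts⊆column B∈firsts) of λ
      { (v , v∈F , refl) → parts⊆ (All.lookup F-wc v∈F) zero }
    rests-bound : ∀ {B} → B ∈ₗ firsts → ∣ B ∣ ! * sum (map factProdSizes (rests B F)) ≤ r ^ q * chainsThrough ∣ T ∣ B
    rests-bound {B} B∈firsts = begin
      ∣ B ∣ ! * sum (map factProdSizes (rests B F))
        ≤⟨ *-monoʳ-≤ (∣ B ∣ !) (productLym q r (T ─ B) (rests B F) (rests-unique F!) (rests-wc F-wc)
                                 (λ k → ChainFreeList-⊆ (column-rests (inject₁ k) B F) (F-cf (suc k)))) ⟩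
      ∣ B ∣ ! * (r ^ q * ∣ T ─ B ∣ !)  ≡⟨ *-x∙yz≈y∙xz (∣ B ∣ !) (r ^ q) _ ⟩
      r ^ q * (∣ B ∣ ! * ∣ T ─ B ∣ !)  ≡⟨ cong (r ^ q *_) (chainsThrough-─ (All.lookup firsts⊆T B∈firsts)) ⟨
      r ^ q * chainsThrough ∣ T ∣ B    ∎

-- Fractional knapsack

AllPairs-reverse⁺ : ∀ {A : Set} {R : A → A → Set} {xs} → AllPairs R xs → AllPairs (flip R) (reverse xs)
AllPairs-reverse⁺ {xs = []}     []           = []
AllPairs-reverse⁺ {xs = x ∷ xs} (Rx ∷ Rxs) rewrite unfold-reverse x xs =
  AllPairs.++⁺ (AllPairs-reverse⁺ Rxs) ([] ∷ []) (All.map (_∷ []) (All-resp-↭ (↭-sym (↭-reverse xs)) Rx))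

threshold : ℕ → List ℕ → ℕ
threshold _       []       = 0
threshold zero    (d ∷ _)  = d
threshold (suc R) (_ ∷ ds) = threshold R ds

threshold-≤ : ∀ R {d ds} → All (_≤ d) ds → threshold R ds ≤ d
threshold-≤ R       []       = z≤n
threshold-≤ zero    (d′≤d ∷ _) = d′≤d
threshold-≤ (suc R) (_ ∷ ds≤d) = threshold-≤ R ds≤d

sum-take-threshold : ∀ R ds → AllPairs _≥_ ds →
                     R * threshold R ds + sum (map (_∸ threshold R ds) ds) ≤ sum (take R ds)
sum-take-threshold zero    []       _              = z≤n
sum-take-threshold (suc R) []       _              = ≤-reflexive (trans (+-identityʳ (R * 0)) (*-zeroʳ R))
sum-take-threshold zero    (d ∷ ds) (ds≤d ∷ _)     = ≤-reflexive (cong₂ _+_ (n∸n≡0 d) rest≡0)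
  where
  rest≡0 : sum (map (_∸ d) ds) ≡ 0
  rest≡0 = trans (cong sum (map-cong-local (All.map m≤n⇒m∸n≡0 ds≤d))) (sum-map-zero ds)
sum-take-threshold (suc R) (d ∷ ds) (ds≤d ∷ ds↘) = begin
  (L + R * L) + ((d ∸ L) + S) ≡⟨ interchange L (R * L) (d ∸ L) S ⟩
  (L + (d ∸ L)) + (R * L + S) ≡⟨ cong (_+ (R * L + S)) (m+[n∸m]≡n (threshold-≤ R ds≤d)) ⟩
  d + (R * L + S)             ≤⟨ +-monoʳ-≤ d (sum-take-threshold R ds ds↘) ⟩
  d + sum (take R ds)         ∎
  where
  open ≤-Reasoning
  L : ℕ
  L = threshold R ds
  S : ℕ
  S = sum (map (_∸ L) ds)

knapsack-item : ∀ {N M d x} L → M * d ≡ N → x * d ≤ N → N * x ≤ L * (x * d) + N * (M ∸ L)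
knapsack-item {N} {M} {d} {x} L Md≡N xd≤N with ≤-total M L
... | inj₁ M≤L = begin
  N * x                      ≡⟨ cong (_* x) Md≡N ⟨
  M * d * x                  ≡⟨ *-xy∙z≈x∙zy M d x ⟩
  M * (x * d)                ≤⟨ *-monoˡ-≤ (x * d) M≤L ⟩
  L * (x * d)                ≤⟨ m≤m+n _ _ ⟩
  L * (x * d) + N * (M ∸ L)  ∎
  where open ≤-Reasoning
... | inj₂ L≤M = begin
  N * x                              ≡⟨ cong (_* x) Md≡N ⟨
  M * d * x                          ≡⟨ *-xy∙z≈x∙zy M d x ⟩
  M * (x * d)                        ≡⟨ cong (_* (x * d)) (m+[n∸m]≡n L≤M) ⟨
  (L + (M ∸ L)) * (x * d)            ≡⟨ *-distribʳ-+ (x * d) L (M ∸ L) ⟩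
  L * (x * d) + (M ∸ L) * (x * d)    ≤⟨ +-monoʳ-≤ (L * (x * d)) (*-monoʳ-≤ (M ∸ L) xd≤N) ⟩
  L * (x * d) + (M ∸ L) * N          ≡⟨ cong (_+_ (L * (x * d))) (*-comm (M ∸ L) N) ⟩
  L * (x * d) + N * (M ∸ L)          ∎
  where open ≤-Reasoning

-- Kind a offers M a items of weight d a = N / M a, and x a of them are taken, of total weight at most R N.
-- With L the (R+1)-st largest M a (0 if there are at most R kinds), each kind satisfies
-- N x ≤ L x d + N (M ∸ L); summing gives N ∑ x ≤ N (R L + ∑ (M ∸ L)), and R L + ∑ (M ∸ L) is at most
-- the sum of the R largest M a.
sum≤sumLargest : ∀ {A : Set} N .{{_ : NonZero N}} R (M d x : A → ℕ) as →
                 All (λ a → M a * d a ≡ N) as → All (λ a → x a * d a ≤ N) as →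
                 sum (map (λ a → x a * d a) as) ≤ R * N → sum (map x as) ≤ sumLargest R (map M as)
sum≤sumLargest N R M d x as Md≡N xd≤N ∑xd≤RN = *-cancelˡ-≤ N (begin
  N * sum (map x as)
    ≡⟨ sum-map-*ˡ N x as ⟨
  sum (map (λ a → N * x a) as)
    ≤⟨ sum-map-mono (All.zipWith (λ (e , le) → knapsack-item L e le) (Md≡N , xd≤N)) ⟩
  sum (map (λ a → L * (x a * d a) + N * (M a ∸ L)) as)
    ≡⟨ sum-map-+ (λ a → L * (x a * d a)) (λ a → N * (M a ∸ L)) as ⟩
  sum (map (λ a → L * (x a * d a)) as) + sum (map (λ a → N * (M a ∸ L)) as)
    ≡⟨ cong₂ _+_ (sum-map-*ˡ L (λ a → x a * d a) as) (sum-map-*ˡ N (λ a → M a ∸ L) as) ⟩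
  L * sum (map (λ a → x a * d a) as) + N * sum (map (λ a → M a ∸ L) as)
    ≤⟨ +-monoˡ-≤ _ (*-monoʳ-≤ L ∑xd≤RN) ⟩
  L * (R * N) + N * sum (map (λ a → M a ∸ L) as)
    ≡⟨ cong₂ _+_ (*-x∙yz≈z∙yx L R N) (cong (N *_) ∑[M∸L]≡∑[ds∸L]) ⟩
  N * (R * L) + N * sum (map (_∸ L) ds)
    ≡⟨ *-distribˡ-+ N (R * L) _ ⟨
  N * (R * L + sum (map (_∸ L) ds))
    ≤⟨ *-monoʳ-≤ N (sum-take-threshold R ds ds↘) ⟩
  N * sumLargest R (map M as) ∎)
  where
  open ≤-Reasoning
  ds : List ℕ
  ds = reverse (sort (map M as))
  ds↘ : AllPairs _≥_ ds
  ds↘ = AllPairs-reverse⁺ (Linked⇒AllPairs ≤-trans (sort-↗ (map M as)))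
  L : ℕ
  L = threshold R ds
  ∑[M∸L]≡∑[ds∸L] : sum (map (λ a → M a ∸ L) as) ≡ sum (map (_∸ L) ds)
  ∑[M∸L]≡∑[ds∸L] = trans (cong sum (map-∘ as))
                         (sum-↭ (↭-map⁺ (_∸ L) (↭-sym (↭-trans (↭-reverse _) (sort-↭ (map M as))))))

-- Counting weak compositions by their size vectors

sameSize⇒ChainFreeList₁ : ∀ {n s} (D : List (Subset n)) → All (λ B → ∣ B ∣ ≡ s) D → ChainFreeList 1 D
sameSize⇒ChainFreeList₁ D D-size []          _ _ _ = z≤n
sameSize⇒ChainFreeList₁ D D-size (_ ∷ [])    _ _ _ = s≤s z≤n
sameSize⇒ChainFreeList₁ D D-size (B ∷ B′ ∷ _) ((B≢B′ ∷ _) ∷ _) C⊆D C-chain =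
  contradiction (case C-chain (here refl) (there (here refl)) of λ
    { (inj₁ B⊆B′) → p⊆q∧∣p∣≡∣q∣⇒p≡q B B′ B⊆B′ (trans (size B∈D) (sym (size B′∈D)))
    ; (inj₂ B′⊆B) → sym (p⊆q∧∣p∣≡∣q∣⇒p≡q B′ B B′⊆B (trans (size B′∈D) (sym (size B∈D)))) })
    B≢B′
  where
  size : ∀ {B} → B ∈ₗ D → ∣ B ∣ ≡ _
  size = All.lookup D-size
  B∈D : B ∈ₗ D
  B∈D = C⊆D (here refl)
  B′∈D : B′ ∈ₗ D
  B′∈D = C⊆D (there (here refl))

allVecs-unique : ∀ p n → Unique (allVecs p n)
allVecs-unique zero    n = [] ∷ []
allVecs-unique (suc p) n = Unique.concat⁺
  (All.map⁺ (All.universal (λ _ → Unique.map⁺ Vec.∷-injectiveʳ (allVecs-unique p n)) (upTo (suc n))))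
  (AllPairs.map⁺ (AllPairs.map disjoint (Unique.upTo⁺ (suc n))))
  where
  disjoint : ∀ {x y} → x ≢ y → Disjoint (map (x ∷_) (allVecs p n)) (map (y ∷_) (allVecs p n))
  disjoint x≢y (v∈x∷ , v∈y∷) with _ , _ , refl ← ∈-map⁻ _ v∈x∷ | _ , _ , eq ← ∈-map⁻ _ v∈y∷ = x≢y (Vec.∷-injectiveˡ eq)

allVecs-∈ : ∀ {p n} (a : Vec ℕ p) → Vec.sum a ≤ n → a ∈ₗ allVecs p n
allVecs-∈ []      _  = here refl
allVecs-∈ {suc p} {n} (x ∷ a) le = ∈-concatMap⁺ (λ y → map (y ∷_) (allVecs p n))
  (Any.map (λ { refl → ∈-map⁺ (x ∷_) (allVecs-∈ a (m+n≤o⇒n≤o x le)) }) (∈-upTo⁺ (s≤s (m+n≤o⇒m≤o x le))))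

factProd∣! : ∀ {p} (a : Vec ℕ p) {n} → Vec.sum a ≡ n → factProd a ∣ n !
factProd∣! []      {n} _     = 1∣ (n !)
factProd∣! (x ∷ a) {n} Σa≡n = ∣-trans (*-monoʳ-∣ (x !) (factProd∣! a Σa≡n∸x)) (k![n∸k]!∣n! x≤n)
  where
  x≤n : x ≤ n
  x≤n = subst (x ≤_) Σa≡n (m≤m+n x _)
  Σa≡n∸x : Vec.sum a ≡ n ∸ x
  Σa≡n∸x = trans (sym (m+n∸m≡n x _)) (cong (_∸ x) Σa≡n)

multinomial*factProd : ∀ {p} n (a : Vec ℕ p) → Vec.sum a ≡ n → multinomial n a * factProd a ≡ n !
multinomial*factProd n a Σa≡n = m/n*n≡m {{factProd≢0 a}} (factProd∣! a Σa≡n)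

module _ {n : ℕ} where

  productLym-⊤ : ∀ q r (F : List (Vec (Subset n) (suc q))) → Unique F → All (IsWeakCompositionOf ⊤) F →
                 (∀ (k : Fin q) → ChainFreeList r (column (inject₁ k) F)) → sum (map factProdSizes F) ≤ r ^ q * n !
  productLym-⊤ q r F F! F-wc F-cf = subst (λ s → sum (map factProdSizes F) ≤ r ^ q * s !) (∣⊤∣≡n n) (productLym q r ⊤ F F! F-wc F-cf)

  length*factProd≤! : ∀ q a (G : List (Vec (Subset n) (suc q))) → Unique G → All (IsWeakCompositionOf ⊤) G →
                      All (λ v → Vec.map ∣_∣ v ≡ a) G → length G * factProd a ≤ n !
  length*factProd≤! q a G G! G-wc G-size = begin
    length G * factProd a      ≡⟨ sum-map-const factProdSizes (All.map (cong factProd) G-size) ⟨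
    sum (map factProdSizes G)  ≤⟨ productLym-⊤ q 1 G G! G-wc (λ k → sameSize⇒ChainFreeList₁ _ (column-size (inject₁ k))) ⟩
    1 ^ q * n !                ≡⟨ cong (_* n !) (^-zeroˡ q) ⟩
    1 * n !                    ≡⟨ *-identityˡ (n !) ⟩
    n !                        ∎
    where
    open ≤-Reasoning
    column-size : ∀ k → All (λ B → ∣ B ∣ ≡ lookup a k) (column k G)
    column-size k = All.map⁺ (All.map (λ {v} v-size → trans (sym (Vec.lookup-map k ∣_∣ v)) (cong (λ s → lookup s k) v-size)) G-size)

  length≤sumLargest : ∀ q r (F : List (Vec (Subset n) (suc q))) → Unique F → All (IsWeakCompositionOf ⊤) F →
                      (∀ (k : Fin q) → ChainFreeList r (column (inject₁ k) F)) →
                      length F ≤ sumLargest (r ^ q) (multinomialCoeffs (suc q) n)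
  length≤sumLargest q r F F! F-wc F-cf = begin
    length F                                          ≡⟨ sum-map-1 F ⟨
    sum (map (λ _ → 1) F)                             ≡⟨ sum-map-fibers _≟ᵥ_ sizesOf (λ _ → 1) F ts! F-sizes ⟨
    sum (map (λ a → sum (map (λ _ → 1) (F[ a ]))) ts) ≡⟨ cong sum (map-cong (λ a → sum-map-1 F[ a ]) ts) ⟩
    sum (map (λ a → length F[ a ]) ts)                ≤⟨ sum≤sumLargest (n !) {{n !≢0}} (r ^ q) (multinomial n) factProd
                                                           (λ a → length F[ a ]) ts multinomial*factProd-ts fiber-bound fibers-bound ⟩
    sumLargest (r ^ q) (multinomialCoeffs (suc q) n)  ∎
    where
    open ≤-Reasoning
    _≟ᵥ_ : DecidableEquality (Vec ℕ (suc q))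
    _≟ᵥ_ = Vec.≡-dec _≟_
    sizesOf : Vec (Subset n) (suc q) → Vec ℕ (suc q)
    sizesOf = Vec.map ∣_∣
    F[_] : Vec ℕ (suc q) → List (Vec (Subset n) (suc q))
    F[ a ] = fiber _≟ᵥ_ sizesOf a F
    F[_]-size : ∀ a → All (λ v → sizesOf v ≡ a) F[ a ]
    F[ a ]-size = All.all-filter (λ v → sizesOf v ≟ᵥ a) F
    ts : List (Vec ℕ (suc q))
    ts = tuplesSumming (suc q) n
    ts! : Unique ts
    ts! = Unique.filter⁺ (λ a → Vec.sum a ≟ n) (allVecs-unique (suc q) n)
    multinomial*factProd-ts : All (λ a → multinomial n a * factProd a ≡ n !) ts
    multinomial*factProd-ts = All.map (λ {a} → multinomial*factProd n a) (All.all-filter (λ a → Vec.sum a ≟ n) (allVecs (suc q) n))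
    F-sizes : All (λ v → sizesOf v ∈ₗ ts) F
    F-sizes = All.map (λ {v} wc → let ∑≡n = trans (IsWeakCompositionOf-sum v wc) (∣⊤∣≡n n) in
                        ∈-filter⁺ (λ a → Vec.sum a ≟ n) (allVecs-∈ (sizesOf v) (≤-reflexive ∑≡n)) ∑≡n) F-wc
    fiber-bound : All (λ a → length F[ a ] * factProd a ≤ n !) ts
    fiber-bound = All.universal (λ a → length*factProd≤! q a F[ a ] (Unique.filter⁺ (λ v → sizesOf v ≟ᵥ a) F!)
                                                        (All.filter⁺ (λ v → sizesOf v ≟ᵥ a) F-wc) F[ a ]-size) ts
    fibers-bound : sum (map (λ a → length F[ a ] * factProd a) ts) ≤ r ^ q * n !
    fibers-bound = begin
      sum (map (λ a → length F[ a ] * factProd a) ts)      ≡⟨ cong sum (map-cong (λ a → sum-map-const factProdSizes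
                                                                 (All.map (cong factProd) F[ a ]-size)) ts) ⟨
      sum (map (λ a → sum (map factProdSizes F[ a ])) ts)  ≡⟨ sum-map-fibers _≟ᵥ_ sizesOf factProdSizes F ts! F-sizes ⟩
      sum (map factProdSizes F)                            ≤⟨ productLym-⊤ q r F F! F-wc F-cf ⟩
      r ^ q * n !                                          ∎

mkℚᵘ-+ : ∀ d a b → mkℚᵘ (+ a) d ℚᵘ.+ mkℚᵘ (+ b) d ℚᵘ.≃ mkℚᵘ (+ (a + b)) d
mkℚᵘ-+ d a b = *≡* (begin
  (+ a ℤ.* D ℤ.+ + b ℤ.* D) ℤ.* D ≡⟨ solve 3 (λ a b D → (a :* D :+ b :* D) :* D := (a :+ b) :* (D :* D)) refl (+ a) (+ b) D ⟩
  (+ a ℤ.+ + b) ℤ.* (D ℤ.* D)     ≡⟨ cong₂ ℤ._*_ (ℤ.pos-+ a b) (ℤ.pos-* (suc d) (suc d)) ⟨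
  + (a + b) ℤ.* + (suc d * suc d) ∎)
  where
  open ≡-Reasoning
  D : ℤ
  D = + suc d

toℚᵘ-sumℚ-/ : ∀ {A : Set} d (f : A → ℕ) xs → toℚᵘ (sumℚ (map (λ x → (+ f x) ℚ./ suc d) xs)) ℚᵘ.≃ mkℚᵘ (+ sum (map f xs)) d
toℚᵘ-sumℚ-/ d f []       = *≡* refl
toℚᵘ-sumℚ-/ d f (x ∷ xs) = ℚᵘ.≃-trans (ℚ.toℚᵘ-homo-+ ((+ f x) ℚ./ suc d) _)
  (ℚᵘ.≃-trans (ℚᵘ.+-cong (ℚ.toℚᵘ-fromℚᵘ (mkℚᵘ (+ f x) d)) (toℚᵘ-sumℚ-/ d f xs)) (mkℚᵘ-+ d (f x) _))

sumℚ-/-≤ : ∀ {A : Set} N .{{_ : NonZero N}} (f : A → ℕ) xs R → sum (map f xs) ≤ R * N →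
           sumℚ (map (λ x → (+ f x) ℚ./ N) xs) ℚ.≤ (+ R) ℚ./ 1
sumℚ-/-≤ (suc d) f xs R ∑f≤RN = ℚ.toℚᵘ-cancel-≤ (begin
  toℚᵘ (sumℚ (map (λ x → (+ f x) ℚ./ suc d) xs)) ≃⟨ toℚᵘ-sumℚ-/ d f xs ⟩
  mkℚᵘ (+ sum (map f xs)) d                       ≤⟨ *≤* (subst₂ ℤ._≤_ (ℤ.pos-* (sum (map f xs)) 1) (ℤ.pos-* R (suc d))
                                                                 (ℤ.+≤+ (subst (_≤ R * suc d) (sym (*-identityʳ _)) ∑f≤RN))) ⟩
  mkℚᵘ (+ R) 0                                    ≃⟨ ℚ.toℚᵘ-fromℚᵘ (mkℚᵘ (+ R) 0) ⟨
  toℚᵘ ((+ R) ℚ./ 1)                              ∎)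
  where open ℚᵘ.≤-Reasoning

ChainFree⇒ChainFreeList : ∀ {m n r} {G : Fin m → Subset n} → ChainFree r G → ChainFreeList r (map G (allFin m))
ChainFree⇒ChainFreeList {m} {G = G} G-cf C C! C⊆ C-chain = G-cf (length C) g g-distinct g-chain
  where
  pick : ∀ a → ∃[ j ] List.lookup C a ≡ G j
  pick a with j , _ , Cₐ≡Gⱼ ← ∈-map⁻ G (C⊆ (∈-lookup a)) = j , Cₐ≡Gⱼ
  g : Fin (length C) → Fin m
  g = proj₁ ∘ pick
  g-distinct : ∀ a b → a ≢ b → G (g a) ≢ G (g b)
  g-distinct a b a≢b Gₐ≡G_b = a≢b (Unique-lookup-injective C! (trans (proj₂ (pick a)) (trans Gₐ≡G_b (sym (proj₂ (pick b))))))
  g-chain : ∀ a b → Comparable (G (g a)) (G (g b))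
  g-chain a b = subst₂ Comparable (proj₂ (pick a)) (proj₂ (pick b)) (C-chain (∈-lookup a) (∈-lookup b))

IsWeakComposition⇒IsWeakCompositionOf⊤ : ∀ {p n} {A : Tuple p n} → IsWeakComposition A → IsWeakCompositionOf ⊤ (Vec.tabulate A)
IsWeakComposition⇒IsWeakCompositionOf⊤ {A = A} (disjoint , covers) = record
  { disjoint = λ {i} {j} x∈Aᵢ x∈Aⱼ → case i Fin.≟ j of λ
      { (yes i≡j) → i≡j
      ; (no i≢j)  → contradiction (_ , x∈p∩q⁺ (part i x∈Aᵢ , part j x∈Aⱼ)) (disjoint i j i≢j) }
  ; covers   = λ {x} _ → case covers x of λ { (i , x∈Aᵢ) → i , subst (x ∈_) (sym (Vec.lookup∘tabulate A i)) x∈Aᵢ }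
  ; parts⊆   = λ _ _ → ∈⊤
  }
  where
  part : ∀ i {x} → x ∈ lookup (Vec.tabulate A) i → x ∈ A i
  part i = subst (_ ∈_) (Vec.lookup∘tabulate A i)

Distinct⇒Unique : ∀ {m p n} {A : Fin m → Tuple p n} → Distinct A → Unique (map (Vec.tabulate ∘ A) (allFin m))
Distinct⇒Unique {m} {A = A} distinct = Unique.map⁺ injective (Unique.allFin⁺ m)
  where
  injective : ∀ {j j′} → Vec.tabulate (A j) ≡ Vec.tabulate (A j′) → j ≡ j′
  injective {j} {j′} Aⱼ≡Aⱼ′ with j Fin.≟ j′
  ... | yes j≡j′ = j≡j′
  ... | no  j≢j′ = contradiction (λ k → trans (sym (Vec.lookup∘tabulate (A j) k))
                                           (trans (cong (λ v → lookup v k) Aⱼ≡Aⱼ′) (Vec.lookup∘tabulate (A j′) k)))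
                                 (distinct j j′ j≢j′)

corollary4p1 : (p r n m : ℕ) → 1 ≤ p → 1 ≤ r →
    (A : Fin m → Tuple p n) →
    (∀ j → IsWeakComposition (A j)) →
    Distinct A →
    (∀ (k : Fin p) → suc (toℕ k) < p → ChainFree r (λ j → A j k)) →
    (sumℚ (map (λ j → invMultinomial n (sizes (A j))) (allFin m)) ℚ.≤ ((+ (r ^ (p ∸ 1))) ℚ./ 1))
    × (m ≤ sumLargest (r ^ (p ∸ 1)) (multinomialCoeffs p n))
corollary4p1 (suc q) r n m _ _ A A-wc A-distinct A-cf =
    sumℚ-/-≤ (n !) {{n !≢0}} (factProd ∘ sizes ∘ A) (allFin m) (r ^ q) weights-bound
  , subst (_≤ _) length-F (length≤sumLargest q r F F! F-wc F-cf)
  where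
  F : List (Vec (Subset n) (suc q))
  F = map (Vec.tabulate ∘ A) (allFin m)
  F! : Unique F
  F! = Distinct⇒Unique A-distinct
  F-wc : All (IsWeakCompositionOf ⊤) F
  F-wc = All.map⁺ (All.universal (IsWeakComposition⇒IsWeakCompositionOf⊤ ∘ A-wc) (allFin m))
  F-cf : ∀ (k : Fin q) → ChainFreeList r (column (inject₁ k) F)
  F-cf k = subst (ChainFreeList r) (trans (map-cong (λ j → sym (Vec.lookup∘tabulate (A j) (inject₁ k))) (allFin m))
                                          (map-∘ (allFin m)))
                 (ChainFree⇒ChainFreeList (A-cf (inject₁ k) (s≤s (subst (_< q) (sym (Fin.toℕ-inject₁ k)) (Fin.toℕ<n k)))))
  length-F : length F ≡ m
  length-F = trans (List.length-map _ (allFin m)) (List.length-tabulate id)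
  weights-bound : sum (map (factProd ∘ sizes ∘ A) (allFin m)) ≤ r ^ q * n !
  weights-bound = subst (_≤ r ^ q * n !) weights≡ (productLym-⊤ q r F F! F-wc F-cf)
    where
    weights≡ : sum (map factProdSizes F) ≡ sum (map (factProd ∘ sizes ∘ A) (allFin m))
    weights≡ = cong sum (trans (sym (map-∘ (allFin m)))
                               (map-cong (λ j → cong factProd (sym (Vec.tabulate-∘ ∣_∣ (A j)))) (allFin m)))
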